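{- A graph $H$ satisfies $\widehat{\Phi}_{\mathsf{even}}(H)\neq 0$ if and only if $H$ is bipartite.
   Context: All graphs are finite, simple and undirected. $\Phi_{\mathsf{even}}$ is the graph property with $\Phi_{\mathsf{even}}(G)=1$ if every vertex of $G$ has even degree and $0$ otherwise. For a graph property $\Phi$ and a graph $H$, the alternating enumerator is $\widehat{\Phi}(H)=(-1)^{|E(H)|}\sum_{S\subseteq E(H)}(-1)^{|S|}\Phi(H[S])$, where $H[S]=(V(H),S)$. -}

module Defs where

open import Data.Bool using (Bool; true; false; if_then_else_; _∧_)
open import Data.Nat using (ℕ; zero; suc; _<ᵇ_; _+_)
open import Data.Nat.Base using (_%_)
open import Data.Fin using (Fin; toℕ; _≟_)
open import Data.List using (List; []; _∷_; _++_; map; concatMap; filter; length; foldr)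
open import Data.List.Base using (allFin)
open import Data.Product using (_×_; _,_; Σ; proj₁; proj₂)
open import Data.Integer using (ℤ; +_; -_; _*_) renaming (_+_ to _+ℤ_)
open import Relation.Binary.PropositionalEquality using (_≡_; _≢_)
open import Relation.Nullary.Decidable using (⌊_⌋)

record Graph (n : ℕ) : Set where
  field
    adj    : Fin n → Fin n → Bool
    sym    : ∀ i j → adj i j ≡ adj j i
    irrefl : ∀ i → adj i i ≡ false
open Graph public

-- An edge {i,j} is represented by the pair (i , j) with toℕ i < toℕ j.
Edge : ℕ → Set
Edge n = Fin n × Fin n

edges : ∀ {n} → Graph n → List (Edge n)
edges {n} G =
  filter (λ e → Data.Bool._≟_ (((toℕ (proj₁ e)) <ᵇ (toℕ (proj₂ e))) ∧ adj G (proj₁ e) (proj₂ e)) true)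
    (concatMap (λ i → map (λ j → (i , j)) (allFin n)) (allFin n))

subsets : ∀ {A : Set} → List A → List (List A)
subsets []       = [] ∷ []
subsets (x ∷ xs) = subsets xs ++ map (x ∷_) (subsets xs)

degree : ∀ {n} → List (Edge n) → Fin n → ℕ
degree S v = foldr (λ e k → (if ⌊ proj₁ e ≟ v ⌋ then 1 else 0) + (if ⌊ proj₂ e ≟ v ⌋ then 1 else 0) + k) 0 S

allB : ∀ {A : Set} → (A → Bool) → List A → Bool
allB p = foldr (λ x b → p x ∧ b) true

Φeven : ∀ {n} → List (Edge n) → ℤ
Φeven {n} S = if allB (λ v → ⌊ Data.Nat._≟_ (degree S v % 2) 0 ⌋) (allFin n) then + 1 else + 0

sign : ℕ → ℤ
sign zero    = + 1
sign (suc k) = - sign k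

sumℤ : List ℤ → ℤ
sumℤ = foldr _+ℤ_ (+ 0)

altEven : ∀ {n} → Graph n → ℤ
altEven G = sign (length (edges G)) * sumℤ (map (λ S → sign (length S) * Φeven S) (subsets (edges G)))

Bipartite : ∀ {n} → Graph n → Set
Bipartite {n} G = Σ (Fin n → Bool) λ c → ∀ i j → adj G i j ≡ true → c i ≢ c j

-- Write ± b for (-1)^b and let x range over the 2ⁿ colourings x : Fin n → Bool, read as
-- vectors over 𝔽₂. Orthogonality of the characters x ↦ ± (x · p) gives
-- 2ⁿ Φeven(S) = Σₓ ± (x · ∂S), where ∂S marks the vertices of odd degree in S, and
-- x · ∂S is the number, mod 2, of edges of S cut by x. Hence
-- 2ⁿ Σ_{S ⊆ E} (-1)^|S| Φeven(S) = Σₓ Π_{e ∈ E} (1 - ± cut x e) = Σₓ [x cuts every edge] 2^|E|,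
-- which is non-zero exactly when some colouring cuts every edge, i.e. when H is bipartite.
module Submission where

open import Defs hiding (sym)
open import Algebra.Bundles using (CommutativeRing)
open import Data.Bool using (Bool; true; false; not; _∧_; _xor_; if_then_else_)
open import Data.Bool.Properties
  using ( T-≡; xor-same; not-involutive; not-distribˡ-xor; xor-identityʳ; ∧-zeroʳ; ∧-identityʳ
        ; ∧-conicalˡ; ∧-conicalʳ; ∧-distribˡ-xor; xor-∧-commutativeRing)
open import Data.Empty using (⊥-elim)
open import Data.Fin using (Fin; zero; suc; toℕ; _≟_)
open import Data.Fin.Properties using (toℕ-injective)
open import Data.Integer using (ℤ; +_; -_; _+_; _*_; 0ℤ; 1ℤ; -1ℤ; _≤_; _<_; +≤+; +<+)
open import Data.Integer.Properties
  using ( neg-involutive; neg-distrib-+; +-identityˡ; +-assoc; +-inverseʳ; +-commutativeSemigroup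
        ; *-identityʳ; *-zeroʳ; *-distribˡ-+; pos-*; +-mono-≤; +-mono-<-≤; +-mono-≤-<; <⇒≢
        ; i*j≡0⇒i≡0∨j≡0)
open import Data.Integer.Tactic.RingSolver using (solve-∀)
open import Data.List using (List; []; _∷_; _++_; map; length; foldr; tabulate; allFin; concatMap)
open import Data.List.Properties using (map-++; map-∘; map-cong)
open import Data.List.Membership.Propositional using (_∈_; lose)
open import Data.List.Membership.Propositional.Properties
  using (∈-map⁺; ∈-concatMap⁺; ∈-filter⁺; ∈-filter⁻; ∈-allFin)
open import Data.List.Relation.Unary.Any using (here; there)
open import Data.Nat as ℕ using (ℕ; zero; suc; _^_; _%_; z≤n)
open import Data.Nat.Properties using (+-identityʳ; m^n>0; <-cmp; <⇒<ᵇ)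
open import Data.Product using (_,_; ∃; proj₁; proj₂; map₂)
open import Data.Sum using ([_,_]′)
open import Data.Vec.Functional using (Vector; tail) renaming (_∷_ to _◂_)
open import Data.Vec.Functional.Properties using (∷-cong)
open import Function using (_∘_)
open import Function.Bundles using (_⇔_; mk⇔; Equivalence)
open import Function.Construct.Composition using (_⇔-∘_)
open import Function.Construct.Symmetry using (⇔-sym)
open import Relation.Binary.Core using (_Preserves_⟶_)
open import Relation.Binary.Definitions using (tri<; tri≈; tri>)
open import Relation.Binary.PropositionalEquality
  using (_≡_; _≢_; refl; sym; trans; cong; cong₂; subst; _≗_; ≢-sym; module ≡-Reasoning)
open import Relation.Nullary using (yes; no)
open import Relation.Nullary.Decidable using (⌊_⌋)

open import Algebra.Properties.CommutativeMonoid.Sum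
  (CommutativeRing.+-commutativeMonoid xor-∧-commutativeRing)
  using (sum; ∑-distrib-+; sum-cong-≗; sum-replicate-zero)
open import Algebra.Properties.CommutativeSemigroup +-commutativeSemigroup using (interchange)

open ≡-Reasoning
open Equivalence using (to; from)

±_ : Bool → ℤ
± false = 1ℤ
± true  = -1ℤ

±-xor : ∀ a b → ± (a xor b) ≡ ± a * ± b
±-xor false false = refl
±-xor false true  = refl
±-xor true  false = refl
±-xor true  true  = refl

±-not : ∀ b → ± (not b) ≡ - ± b
±-not false = refl
±-not true  = refl

1+-±≡if : ∀ b → 1ℤ + - ± b ≡ (if b then + 2 else 0ℤ)
1+-±≡if false = refl
1+-±≡if true  = refl

if-double : ∀ b k → (if b then + k else 0ℤ) + (if b then + k else 0ℤ) ≡ (if b then + (2 ℕ.* k) else 0ℤ)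
if-double false k = refl
if-double true  k = cong (λ m → + (k ℕ.+ m)) (sym (+-identityʳ k))

*-if : ∀ k b → + k * (if b then + 1 else + 0) ≡ (if b then + k else 0ℤ)
*-if k false = *-zeroʳ (+ k)
*-if k true  = *-identityʳ (+ k)

sign≢0 : ∀ k → sign k ≢ 0ℤ
sign≢0 zero    ()
sign≢0 (suc k) -s≡0 = sign≢0 k (trans (sym (neg-involutive (sign k))) (cong -_ -s≡0))

2^n≢0 : ∀ n → + (2 ^ n) ≢ 0ℤ
2^n≢0 n = ≢-sym (<⇒≢ (+<+ (m^n>0 2 n)))

*-≢0⇔ : ∀ {k} a → k ≢ 0ℤ → (k * a ≢ 0ℤ ⇔ a ≢ 0ℤ)
*-≢0⇔ {k} a k≢0 = mk⇔
  (λ ka≢0 a≡0 → ka≢0 (trans (cong (k *_) a≡0) (*-zeroʳ k)))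
  (λ a≢0 ka≡0 → [ k≢0 , a≢0 ]′ (i*j≡0⇒i≡0∨j≡0 k ka≡0))

≡⇒≢0⇔ : ∀ {a b} → a ≡ b → (a ≢ 0ℤ ⇔ b ≢ 0ℤ)
≡⇒≢0⇔ a≡b = mk⇔ (subst (_≢ 0ℤ) a≡b) (subst (_≢ 0ℤ) (sym a≡b))

odd : ℕ → Bool
odd zero    = false
odd (suc k) = not (odd k)

odd-+ : ∀ m n → odd (m ℕ.+ n) ≡ odd m xor odd n
odd-+ zero    n = refl
odd-+ (suc m) n = trans (cong not (odd-+ m n)) (not-distribˡ-xor (odd m) (odd n))

odd-if : ∀ b → odd (if b then 1 else 0) ≡ b
odd-if false = refl
odd-if true  = refl

⌊%2≟0⌋≡not-odd : ∀ d → ⌊ d % 2 ℕ.≟ 0 ⌋ ≡ not (odd d)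
⌊%2≟0⌋≡not-odd zero          = refl
⌊%2≟0⌋≡not-odd (suc zero)    = refl
⌊%2≟0⌋≡not-odd (suc (suc d)) = trans (⌊%2≟0⌋≡not-odd d) (cong not (sym (not-involutive (odd d))))

⌊suc≟suc⌋ : ∀ {n} (u v : Fin n) → ⌊ suc u ≟ suc v ⌋ ≡ ⌊ u ≟ v ⌋
⌊suc≟suc⌋ u v with u ≟ v
... | yes _ = refl
... | no  _ = refl

xor≡true⇔≢ : ∀ a b → a xor b ≡ true ⇔ a ≢ b
xor≡true⇔≢ a b = mk⇔ (xor≡true⇒≢ a b) (≢⇒xor≡true a b)
  where
  xor≡true⇒≢ : ∀ a b → a xor b ≡ true → a ≢ b
  xor≡true⇒≢ a .a a⊕a≡true refl with trans (sym (xor-same a)) a⊕a≡true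
  ... | ()
  ≢⇒xor≡true : ∀ a b → a ≢ b → a xor b ≡ true
  ≢⇒xor≡true false false a≢b = ⊥-elim (a≢b refl)
  ≢⇒xor≡true false true  _   = refl
  ≢⇒xor≡true true  false _   = refl
  ≢⇒xor≡true true  true  a≢b = ⊥-elim (a≢b refl)

allB-cong : ∀ {A : Set} {p q : A → Bool} → p ≗ q → ∀ xs → allB p xs ≡ allB q xs
allB-cong p≗q []       = refl
allB-cong p≗q (a ∷ xs) = cong₂ _∧_ (p≗q a) (allB-cong p≗q xs)

allB-tabulate : ∀ {A : Set} {n} (q : A → Bool) (f : Fin n → A) → allB q (tabulate f) ≡ allB (q ∘ f) (allFin n)
allB-tabulate {n = zero}  q f = refl
allB-tabulate {n = suc n} q f =
  cong (q (f zero) ∧_) (trans (allB-tabulate q (f ∘ suc)) (sym (allB-tabulate (q ∘ f) suc)))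

allB≡true⇔ : ∀ {A : Set} (p : A → Bool) xs → allB p xs ≡ true ⇔ (∀ {a} → a ∈ xs → p a ≡ true)
allB≡true⇔ p xs = mk⇔ (allB⇒ xs) (⇒allB xs)
  where
  allB⇒ : ∀ xs → allB p xs ≡ true → ∀ {a} → a ∈ xs → p a ≡ true
  allB⇒ (b ∷ xs) all≡true (here refl)  = ∧-conicalˡ _ _ all≡true
  allB⇒ (b ∷ xs) all≡true (there a∈xs) = allB⇒ xs (∧-conicalʳ _ _ all≡true) a∈xs
  ⇒allB : ∀ xs → (∀ {a} → a ∈ xs → p a ≡ true) → allB p xs ≡ true
  ⇒allB []       _   = refl
  ⇒allB (b ∷ xs) all = cong₂ _∧_ (all (here refl)) (⇒allB xs (all ∘ there))

productℤ : List ℤ → ℤ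
productℤ = foldr _*_ 1ℤ

sumℤ-++ : ∀ xs ys → sumℤ (xs ++ ys) ≡ sumℤ xs + sumℤ ys
sumℤ-++ []       ys = sym (+-identityˡ (sumℤ ys))
sumℤ-++ (x ∷ xs) ys = trans (cong (_+_ x) (sumℤ-++ xs ys)) (sym (+-assoc x (sumℤ xs) (sumℤ ys)))

*-distribˡ-sumℤ : ∀ {A : Set} k (f : A → ℤ) xs → k * sumℤ (map f xs) ≡ sumℤ (map (λ a → k * f a) xs)
*-distribˡ-sumℤ k f []       = *-zeroʳ k
*-distribˡ-sumℤ k f (a ∷ xs) = trans (*-distribˡ-+ k (f a) _) (cong (_+_ (k * f a)) (*-distribˡ-sumℤ k f xs))

sumℤ-subsets-productℤ : ∀ {A : Set} (w : A → ℤ) xs →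
  sumℤ (map (productℤ ∘ map w) (subsets xs)) ≡ productℤ (map (λ a → 1ℤ + w a) xs)
sumℤ-subsets-productℤ w []       = refl
sumℤ-subsets-productℤ w (a ∷ xs) = begin
  sumℤ (map P (subsets xs ++ map (a ∷_) (subsets xs)))           ≡⟨ cong sumℤ (map-++ P (subsets xs) _) ⟩
  sumℤ (map P (subsets xs) ++ map P (map (a ∷_) (subsets xs)))   ≡⟨ sumℤ-++ (map P (subsets xs)) _ ⟩
  Σ + sumℤ (map P (map (a ∷_) (subsets xs)))                     ≡⟨ cong (λ ys → Σ + sumℤ ys) (map-∘ (subsets xs)) ⟨
  Σ + sumℤ (map (λ S → w a * P S) (subsets xs))                  ≡⟨ cong (_+_ Σ) (*-distribˡ-sumℤ (w a) P (subsets xs)) ⟨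
  Σ + w a * Σ                                                     ≡⟨ factor Σ (w a) ⟩
  (1ℤ + w a) * Σ                                                  ≡⟨ cong ((1ℤ + w a) *_) (sumℤ-subsets-productℤ w xs) ⟩
  (1ℤ + w a) * productℤ (map (λ a → 1ℤ + w a) xs)               ∎
  where
  P = productℤ ∘ map w
  Σ = sumℤ (map P (subsets xs))
  factor : ∀ s t → s + t * s ≡ (1ℤ + t) * s
  factor = solve-∀

productℤ-if : ∀ {A : Set} k (p : A → Bool) xs →
  productℤ (map (λ a → if p a then + k else 0ℤ) xs) ≡ (if allB p xs then + (k ^ length xs) else 0ℤ)
productℤ-if k p []       = refl
productℤ-if k p (a ∷ xs) with p a | allB p xs | productℤ-if k p xs
... | false | _     | _  = refl
... | true  | false | ih = trans (cong (+ k *_) ih) (*-zeroʳ (+ k))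
... | true  | true  | ih = trans (cong (+ k *_) ih) (sym (pos-* k (k ^ length xs)))

-- Sums over the Boolean cube

∑ᶜ : ∀ n → (Vector Bool n → ℤ) → ℤ
∑ᶜ zero    f = f (λ ())
∑ᶜ (suc n) f = ∑ᶜ n (λ x → f (false ◂ x)) + ∑ᶜ n (λ x → f (true ◂ x))

∑ᶜ-cong : ∀ n {f g : Vector Bool n → ℤ} → (∀ x → f x ≡ g x) → ∑ᶜ n f ≡ ∑ᶜ n g
∑ᶜ-cong zero    f≡g = f≡g _
∑ᶜ-cong (suc n) f≡g = cong₂ _+_ (∑ᶜ-cong n (f≡g ∘ (false ◂_))) (∑ᶜ-cong n (f≡g ∘ (true ◂_)))

∑ᶜ-0 : ∀ n → ∑ᶜ n (λ _ → 0ℤ) ≡ 0ℤ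
∑ᶜ-0 zero    = refl
∑ᶜ-0 (suc n) = cong₂ _+_ (∑ᶜ-0 n) (∑ᶜ-0 n)

∑ᶜ-neg : ∀ n f → ∑ᶜ n (λ x → - f x) ≡ - ∑ᶜ n f
∑ᶜ-neg zero    f = refl
∑ᶜ-neg (suc n) f =
  trans (cong₂ _+_ (∑ᶜ-neg n _) (∑ᶜ-neg n _)) (sym (neg-distrib-+ (∑ᶜ n _) (∑ᶜ n _)))

∑ᶜ-+ : ∀ n f g → ∑ᶜ n (λ x → f x + g x) ≡ ∑ᶜ n f + ∑ᶜ n g
∑ᶜ-+ zero    f g = refl
∑ᶜ-+ (suc n) f g =
  trans (cong₂ _+_ (∑ᶜ-+ n _ _) (∑ᶜ-+ n _ _)) (interchange (∑ᶜ n _) (∑ᶜ n _) (∑ᶜ n _) (∑ᶜ n _))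

∑ᶜ-*ˡ : ∀ n k f → ∑ᶜ n (λ x → k * f x) ≡ k * ∑ᶜ n f
∑ᶜ-*ˡ zero    k f = refl
∑ᶜ-*ˡ (suc n) k f =
  trans (cong₂ _+_ (∑ᶜ-*ˡ n k _) (∑ᶜ-*ˡ n k _)) (sym (*-distribˡ-+ k (∑ᶜ n _) (∑ᶜ n _)))

sumℤ-∑ᶜ-comm : ∀ n {A : Set} (f : A → Vector Bool n → ℤ) xs →
  sumℤ (map (λ a → ∑ᶜ n (f a)) xs) ≡ ∑ᶜ n (λ x → sumℤ (map (λ a → f a x) xs))
sumℤ-∑ᶜ-comm n f []       = sym (∑ᶜ-0 n)
sumℤ-∑ᶜ-comm n f (a ∷ xs) = trans (cong (_+_ (∑ᶜ n (f a))) (sumℤ-∑ᶜ-comm n f xs)) (sym (∑ᶜ-+ n (f a) _))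

∑ᶜ≢0⇒∃ : ∀ n f → ∑ᶜ n f ≢ 0ℤ → ∃ λ x → f x ≢ 0ℤ
∑ᶜ≢0⇒∃ zero    f ∑≢0 = _ , ∑≢0
∑ᶜ≢0⇒∃ (suc n) f ∑≢0 with ∑ᶜ n (λ x → f (false ◂ x)) Data.Integer.≟ 0ℤ
... | no  ∑₀≢0 = let x , fx≢0 = ∑ᶜ≢0⇒∃ n _ ∑₀≢0 in false ◂ x , fx≢0
... | yes ∑₀≡0 = let x , fx≢0 = ∑ᶜ≢0⇒∃ n _ (λ ∑₁≡0 → ∑≢0 (cong₂ _+_ ∑₀≡0 ∑₁≡0)) in true ◂ x , fx≢0

∑ᶜ-nonneg : ∀ n f → (∀ x → 0ℤ ≤ f x) → 0ℤ ≤ ∑ᶜ n f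
∑ᶜ-nonneg zero    f f≥0 = f≥0 _
∑ᶜ-nonneg (suc n) f f≥0 = +-mono-≤ (∑ᶜ-nonneg n _ (f≥0 ∘ (false ◂_))) (∑ᶜ-nonneg n _ (f≥0 ∘ (true ◂_)))

-- ∑ᶜ evaluates f at colourings assembled by _◂_, which equal x only pointwise;
-- hence the hypothesis that f respects _≗_.
∑ᶜ-pos : ∀ n f → f Preserves _≗_ ⟶ _≡_ → (∀ x → 0ℤ ≤ f x) → ∀ x → 0ℤ < f x → 0ℤ < ∑ᶜ n f
∑ᶜ-pos zero    f f-ext f≥0 x fx>0 = subst (0ℤ <_) (f-ext (λ ())) fx>0
∑ᶜ-pos (suc n) f f-ext f≥0 x fx>0 = split (x zero) refl
  where
  half-pos : ∀ {b} → x zero ≡ b → 0ℤ < ∑ᶜ n (λ y → f (b ◂ y))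
  half-pos x₀≡b = ∑ᶜ-pos n _ (λ y≗z → f-ext (∷-cong refl y≗z)) (f≥0 ∘ (_ ◂_)) (tail x)
    (subst (0ℤ <_) (f-ext (∷-cong x₀≡b λ _ → refl)) fx>0)
  split : ∀ b → x zero ≡ b → 0ℤ < ∑ᶜ (suc n) f
  split false x₀≡b = +-mono-<-≤ (half-pos x₀≡b) (∑ᶜ-nonneg n _ (f≥0 ∘ (true ◂_)))
  split true  x₀≡b = +-mono-≤-< (∑ᶜ-nonneg n _ (f≥0 ∘ (false ◂_))) (half-pos x₀≡b)

∑ᶜ-if≢0⇔ : ∀ n {k} (g : Vector Bool n → Bool) → g Preserves _≗_ ⟶ _≡_ → 0 ℕ.< k →
  ∑ᶜ n (λ x → if g x then + k else 0ℤ) ≢ 0ℤ ⇔ (∃ λ x → g x ≡ true)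
∑ᶜ-if≢0⇔ n {k} g g-ext k>0 = mk⇔
  (λ ∑≢0 → map₂ (F′≢0⇒true _) (∑ᶜ≢0⇒∃ n F ∑≢0))
  (λ (x , gx≡true) → ≢-sym (<⇒≢ (∑ᶜ-pos n F (cong F′ ∘ g-ext) (F′≥0 ∘ g) x
                                  (subst (λ b → 0ℤ < F′ b) (sym gx≡true) (+<+ k>0)))))
  where
  F′ : Bool → ℤ
  F′ b = if b then + k else 0ℤ
  F : Vector Bool n → ℤ
  F = F′ ∘ g
  F′≥0 : ∀ b → 0ℤ ≤ F′ b
  F′≥0 false = +≤+ z≤n
  F′≥0 true  = +≤+ z≤n
  F′≢0⇒true : ∀ b → F′ b ≢ 0ℤ → b ≡ true
  F′≢0⇒true false F′b≢0 = ⊥-elim (F′b≢0 refl)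
  F′≢0⇒true true  _     = refl

-- Characters of 𝔽₂ⁿ

_·_ : ∀ {n} → Vector Bool n → Vector Bool n → Bool
x · p = sum (λ v → x v ∧ p v)

·-congʳ : ∀ {n} (x : Vector Bool n) {p q} → p ≗ q → x · p ≡ x · q
·-congʳ x p≗q = sum-cong-≗ (λ v → cong (x v ∧_) (p≗q v))

·-zeroʳ : ∀ {n} (x : Vector Bool n) → x · (λ _ → false) ≡ false
·-zeroʳ {n} x = trans (sum-cong-≗ (λ v → ∧-zeroʳ (x v))) (sum-replicate-zero n)

·-distribʳ-xor : ∀ {n} (x p q : Vector Bool n) → x · (λ v → p v xor q v) ≡ (x · p) xor (x · q)
·-distribʳ-xor x p q =
  trans (sum-cong-≗ (λ v → ∧-distribˡ-xor (x v) (p v) (q v))) (∑-distrib-+ (λ v → x v ∧ p v) (λ v → x v ∧ q v))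

·-indicator : ∀ {n} (x : Vector Bool n) u → x · (λ v → ⌊ u ≟ v ⌋) ≡ x u
·-indicator x zero    = trans (cong₂ _xor_ (∧-identityʳ (x zero)) (·-zeroʳ (tail x))) (xor-identityʳ (x zero))
·-indicator x (suc u) =
  trans (cong₂ _xor_ (∧-zeroʳ (x zero)) (·-congʳ (tail x) (⌊suc≟suc⌋ u))) (·-indicator (tail x) u)

∑ᶜ-±· : ∀ n (p : Vector Bool n) →
  ∑ᶜ n (λ x → ± (x · p)) ≡ (if allB (not ∘ p) (allFin n) then + (2 ^ n) else 0ℤ)
∑ᶜ-±· zero    p = refl
∑ᶜ-±· (suc n) p with p zero | ∑ᶜ-±· n (tail p)
... | false | ih = begin
  A + A
    ≡⟨ cong₂ _+_ ih ih ⟩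
  I + I
    ≡⟨ if-double all₁ (2 ^ n) ⟩
  (if all₁ then + (2 ^ suc n) else 0ℤ)
    ≡⟨ cong (λ b → if b then + (2 ^ suc n) else 0ℤ) (allB-tabulate (not ∘ p) suc) ⟨
  (if allB (not ∘ p) (tabulate suc) then + (2 ^ suc n) else 0ℤ) ∎
  where
  A = ∑ᶜ n (λ x → ± (x · tail p))
  all₁ = allB (not ∘ tail p) (allFin n)
  I = if all₁ then + (2 ^ n) else 0ℤ
... | true  | _  = begin
  A + ∑ᶜ n (λ x → ± (not (x · tail p)))  ≡⟨ cong (_+_ A) (∑ᶜ-cong n (±-not ∘ (_· tail p))) ⟩
  A + ∑ᶜ n (λ x → - ± (x · tail p))      ≡⟨ cong (_+_ A) (∑ᶜ-neg n _) ⟩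
  A + - A                                 ≡⟨ +-inverseʳ A ⟩
  0ℤ                                      ∎
  where
  A = ∑ᶜ n (λ x → ± (x · tail p))

-- Even subgraphs and cuts

∂ : ∀ {n} → List (Edge n) → Vector Bool n
∂ S v = odd (degree S v)

cut : ∀ {n} → Vector Bool n → Edge n → Bool
cut x e = x (proj₁ e) xor x (proj₂ e)

cut-cong : ∀ {n} {x y : Vector Bool n} → x ≗ y → cut x ≗ cut y
cut-cong x≗y e = cong₂ _xor_ (x≗y (proj₁ e)) (x≗y (proj₂ e))

∂-∷ : ∀ {n} u w (S : List (Edge n)) v → ∂ ((u , w) ∷ S) v ≡ (⌊ u ≟ v ⌋ xor ⌊ w ≟ v ⌋) xor ∂ S v
∂-∷ u w S v =
  trans (odd-+ (δ u ℕ.+ δ w) (degree S v))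
        (cong (_xor ∂ S v) (trans (odd-+ (δ u) (δ w)) (cong₂ _xor_ (odd-if ⌊ u ≟ v ⌋) (odd-if ⌊ w ≟ v ⌋))))
  where
  δ : _ → ℕ
  δ u = if ⌊ u ≟ v ⌋ then 1 else 0

·-∂-∷ : ∀ {n} (x : Vector Bool n) u w S → x · ∂ ((u , w) ∷ S) ≡ cut x (u , w) xor (x · ∂ S)
·-∂-∷ x u w S = begin
  x · ∂ ((u , w) ∷ S)                           ≡⟨ ·-congʳ x (∂-∷ u w S) ⟩
  x · (λ v → (δ u v xor δ w v) xor ∂ S v)      ≡⟨ ·-distribʳ-xor x _ (∂ S) ⟩
  (x · (λ v → δ u v xor δ w v)) xor (x · ∂ S)  ≡⟨ cong (_xor (x · ∂ S)) (·-distribʳ-xor x (δ u) (δ w)) ⟩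
  ((x · δ u) xor (x · δ w)) xor (x · ∂ S)      ≡⟨ cong (_xor (x · ∂ S)) (cong₂ _xor_ (·-indicator x u) (·-indicator x w)) ⟩
  (x u xor x w) xor (x · ∂ S)                   ∎
  where
  δ : _ → Vector Bool _
  δ u v = ⌊ u ≟ v ⌋

sign*±·∂ : ∀ {n} (x : Vector Bool n) S → sign (length S) * ± (x · ∂ S) ≡ productℤ (map (λ e → - ± cut x e) S)
sign*±·∂ x []            = cong (λ b → 1ℤ * ± b) (·-zeroʳ x)
sign*±·∂ x ((u , w) ∷ S) = begin
  - s * ± (x · ∂ ((u , w) ∷ S))    ≡⟨ cong (λ b → - s * ± b) (·-∂-∷ x u w S) ⟩
  - s * ± (c xor (x · ∂ S))         ≡⟨ cong (- s *_) (±-xor c (x · ∂ S)) ⟩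
  - s * (± c * ± (x · ∂ S))         ≡⟨ regroup s (± c) (± (x · ∂ S)) ⟩
  - ± c * (s * ± (x · ∂ S))         ≡⟨ cong (- ± c *_) (sign*±·∂ x S) ⟩
  - ± c * productℤ (map (λ e → - ± cut x e) S) ∎
  where
  s = sign (length S)
  c = cut x (u , w)
  regroup : ∀ a b d → - a * (b * d) ≡ - b * (a * d)
  regroup = solve-∀

Φeven≡if : ∀ {n} (S : List (Edge n)) → Φeven S ≡ (if allB (not ∘ ∂ S) (allFin n) then + 1 else + 0)
Φeven≡if {n} S =
  cong (λ b → if b then + 1 else + 0) (allB-cong (λ v → ⌊%2≟0⌋≡not-odd (degree S v)) (allFin n))

2^n*Φeven : ∀ n (S : List (Edge n)) → + (2 ^ n) * Φeven S ≡ ∑ᶜ n (λ x → ± (x · ∂ S))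
2^n*Φeven n S = begin
  + (2 ^ n) * Φeven S                                              ≡⟨ cong (+ (2 ^ n) *_) (Φeven≡if S) ⟩
  + (2 ^ n) * (if allB (not ∘ ∂ S) (allFin n) then + 1 else + 0)   ≡⟨ *-if (2 ^ n) _ ⟩
  (if allB (not ∘ ∂ S) (allFin n) then + (2 ^ n) else 0ℤ)          ≡⟨ ∑ᶜ-±· n (∂ S) ⟨
  ∑ᶜ n (λ x → ± (x · ∂ S))                                         ∎

2^n*sign*Φeven : ∀ n (S : List (Edge n)) →
  + (2 ^ n) * (sign (length S) * Φeven S) ≡ ∑ᶜ n (λ x → productℤ (map (λ e → - ± cut x e) S))
2^n*sign*Φeven n S = begin
  + (2 ^ n) * (s * Φeven S)      ≡⟨ swap (+ (2 ^ n)) s (Φeven S) ⟩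
  s * (+ (2 ^ n) * Φeven S)      ≡⟨ cong (s *_) (2^n*Φeven n S) ⟩
  s * ∑ᶜ n (λ x → ± (x · ∂ S))   ≡⟨ ∑ᶜ-*ˡ n s _ ⟨
  ∑ᶜ n (λ x → s * ± (x · ∂ S))   ≡⟨ ∑ᶜ-cong n (λ x → sign*±·∂ x S) ⟩
  ∑ᶜ n (λ x → productℤ (map (λ e → - ± cut x e) S)) ∎
  where
  s = sign (length S)
  swap : ∀ a b c → a * (b * c) ≡ b * (a * c)
  swap = solve-∀

signedEvenSum : ∀ {n} → List (Edge n) → ℤ
signedEvenSum E = sumℤ (map (λ S → sign (length S) * Φeven S) (subsets E))

2^n*signedEvenSum : ∀ n (E : List (Edge n)) →
  + (2 ^ n) * signedEvenSum E ≡ ∑ᶜ n (λ x → if allB (cut x) E then + (2 ^ length E) else 0ℤ)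
2^n*signedEvenSum n E = begin
  + (2 ^ n) * signedEvenSum E
    ≡⟨ *-distribˡ-sumℤ (+ (2 ^ n)) _ (subsets E) ⟩
  sumℤ (map (λ S → + (2 ^ n) * (sign (length S) * Φeven S)) (subsets E))
    ≡⟨ cong sumℤ (map-cong (2^n*sign*Φeven n) (subsets E)) ⟩
  sumℤ (map (λ S → ∑ᶜ n (λ x → productℤ (map (w x) S))) (subsets E))
    ≡⟨ sumℤ-∑ᶜ-comm n (λ S x → productℤ (map (w x) S)) (subsets E) ⟩
  ∑ᶜ n (λ x → sumℤ (map (productℤ ∘ map (w x)) (subsets E)))
    ≡⟨ ∑ᶜ-cong n (λ x → sumℤ-subsets-productℤ (w x) E) ⟩
  ∑ᶜ n (λ x → productℤ (map (λ e → 1ℤ + w x e) E))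
    ≡⟨ ∑ᶜ-cong n (λ x → trans (cong productℤ (map-cong (1+-±≡if ∘ cut x) E)) (productℤ-if 2 (cut x) E)) ⟩
  ∑ᶜ n (λ x → if allB (cut x) E then + (2 ^ length E) else 0ℤ) ∎
  where
  w : Vector Bool n → Edge n → ℤ
  w x e = - ± cut x e

signedEvenSum≢0⇔ : ∀ n (E : List (Edge n)) → signedEvenSum E ≢ 0ℤ ⇔ (∃ λ x → allB (cut x) E ≡ true)
signedEvenSum≢0⇔ n E =
  ∑ᶜ-if≢0⇔ n (λ x → allB (cut x) E) (λ x≗y → allB-cong (cut-cong x≗y) E) (m^n>0 2 (length E))
    ⇔-∘ (≡⇒≢0⇔ (2^n*signedEvenSum n E) ⇔-∘ ⇔-sym (*-≢0⇔ (signedEvenSum E) (2^n≢0 n)))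

adj⇒≢ : ∀ {n} (G : Graph n) {i j} → adj G i j ≡ true → i ≢ j
adj⇒≢ G {i} ij refl with trans (sym (irrefl G i)) ij
... | ()

∈-edges⁺ : ∀ {n} (G : Graph n) {i j} → toℕ i ℕ.< toℕ j → adj G i j ≡ true → (i , j) ∈ edges G
∈-edges⁺ G {i} {j} i<j ij =
  ∈-filter⁺ _ (∈-concatMap⁺ _ (lose (∈-allFin i) (∈-map⁺ (i ,_) (∈-allFin j)))) (cong₂ _∧_ (to T-≡ (<⇒<ᵇ i<j)) ij)

∈-edges⁻ : ∀ {n} (G : Graph n) {e} → e ∈ edges G → adj G (proj₁ e) (proj₂ e) ≡ true
∈-edges⁻ {n} G e∈ = ∧-conicalʳ _ _ (proj₂ (∈-filter⁻ edge? {xs = pairs} e∈))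
  where
  edge? = λ (e : Edge n) → ((toℕ (proj₁ e) ℕ.<ᵇ toℕ (proj₂ e)) ∧ adj G (proj₁ e) (proj₂ e)) Data.Bool.≟ true
  pairs = concatMap (λ i → map (i ,_) (allFin n)) (allFin n)

allB-cut⇔proper : ∀ {n} (G : Graph n) (x : Vector Bool n) →
  allB (cut x) (edges G) ≡ true ⇔ (∀ i j → adj G i j ≡ true → x i ≢ x j)
allB-cut⇔proper G x = mk⇔ proper
  (λ x-proper → from all-cut⇔ (λ e∈ → from (xor≡true⇔≢ _ _) (x-proper _ _ (∈-edges⁻ G e∈))))
  where
  all-cut⇔ = allB≡true⇔ (cut x) (edges G)
  cut-edge : allB (cut x) (edges G) ≡ true → ∀ {i j} → (i , j) ∈ edges G → x i ≢ x j
  cut-edge all-cut e∈ = to (xor≡true⇔≢ _ _) (to all-cut⇔ all-cut e∈)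
  proper : allB (cut x) (edges G) ≡ true → ∀ i j → adj G i j ≡ true → x i ≢ x j
  proper all-cut i j ij with <-cmp (toℕ i) (toℕ j)
  ... | tri< i<j _ _ = cut-edge all-cut (∈-edges⁺ G i<j ij)
  ... | tri≈ _ i≡j _ = ⊥-elim (adj⇒≢ G ij (toℕ-injective i≡j))
  ... | tri> _ _ j<i = ≢-sym (cut-edge all-cut (∈-edges⁺ G j<i (trans (Graph.sym G j i) ij)))

∃allB-cut⇔Bipartite : ∀ {n} (G : Graph n) → (∃ λ x → allB (cut x) (edges G) ≡ true) ⇔ Bipartite G
∃allB-cut⇔Bipartite G =
  mk⇔ (map₂ λ {x} → to (allB-cut⇔proper G x)) (map₂ λ {x} → from (allB-cut⇔proper G x))

theorem6p1 : (n : ℕ) (H : Graph n) → (altEven H ≢ + 0) ⇔ Bipartite H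
theorem6p1 n H =
  ∃allB-cut⇔Bipartite H ⇔-∘ (signedEvenSum≢0⇔ n E ⇔-∘ *-≢0⇔ (signedEvenSum E) (sign≢0 (length E)))
  where
  E = edges H
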